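{- Let $\mathfrak F=(X,R,E)$ be a descriptive $\mathbf{MGrz}$-frame and $x\in X$. (1) If $\mathbf{max}_R E_Q[x]\neq\varnothing$, then $E_Q[x]=E[x]$. (2) If $x\in\mathbf{smax}_R U$ for some clopen $U\subseteq X$, then $E_Q[x]=E[x]$. (3) If $(X,R,E)$ is a finite $\mathbf{MGrz}$-frame, then $E_Q=E$.
   Context: An $\mathbf{MK}$-frame is $(X,R,E)$, $X\neq\varnothing$, $R\subseteq X^2$, $E$ an equivalence relation, with $x\mathrel Ey$, $y\mathrel Rz$ implying $x\mathrel Ru$, $u\mathrel Ez$ for some $u$. A descriptive $\mathbf{MGrz}$-frame is an $\mathbf{MK}$-frame where $X$ is a Stone space, $R$ and $E$ are continuous (successor sets of points closed; predecessor sets of clopens clopen), and the algebra of clopens with $\Diamond U=R^{ -1}[U]$, $\exists U=E[U]$ validates all theorems of $\mathbf{MGrz}$ (least monadic extension of $\mathbf{Grz}=\mathbf{S4}+\Box(\Box(p\to\Box p)\to p)\to p$ with $\mathbf{S5}$ axioms for $\exists$ and $\exists\Diamond p\to\Diamond\exists p$); a finite $\mathbf{MGrz}$-frame (with discrete topology) is an instance. $Q=E\circ R$ ($x\mathrel Qy$ iff $x\mathrel Rz$, $z\mathrel Ey$ for some $z$), and $E_Q[x]=\{y: x\mathrel Qy$ and $y\mathrel Qx\}$ is the $Q$-cluster of $x$; $E_Q$ is the corresponding equivalence relation. $\mathbf{max}_R V=\{x\in V:\forall y\in V(x\mathrel Ry\Rightarrow y=x)\}$; $\mathbf{smax}_R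 V=\{x\in\mathbf{max}_R V:\forall y\in V(x\mathrel Qy\Rightarrow x\mathrel Ey)\}$. -}

module Defs where

open import Data.Nat using (ℕ)
open import Data.Fin using (Fin)
open import Data.List using (List)
open import Data.List.Relation.Unary.Any using (Any)
open import Data.Product using (Σ; ∃; _×_; _,_)
open import Data.Empty using (⊥)
open import Data.Unit using (⊤)
open import Relation.Nullary using (¬_)
open import Relation.Binary using (IsEquivalence)
open import Relation.Binary.PropositionalEquality using (_≡_)
open import Function.Bundles using (_↔_; _⇔_)

Subset : Set → Set₁
Subset X = X → Set

module _ {X : Set} where
  _⊆_ : Subset X → Subset X → Set
  U ⊆ V = ∀ x → U x → V x

  ∁ : Subset X → Subset X
  ∁ U x = ¬ U x

record Topology (X : Set) : Set₁ where
  field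
    Open     : Subset X → Set
    open-ext : ∀ {U V} → U ⊆ V → V ⊆ U → Open U → Open V
    open-all : Open (λ _ → ⊤)
    open-∩   : ∀ {U V} → Open U → Open V → Open (λ x → U x × V x)
    open-⋃   : (I : Set) (U : I → Subset X) → (∀ i → Open (U i)) →
               Open (λ x → ∃ λ i → U i x)

  Closed : Subset X → Set
  Closed U = Open (∁ U)

  Clopen : Subset X → Set
  Clopen U = Open U × Closed U

  Compact : Set₁
  Compact = (I : Set) (U : I → Subset X) → (∀ i → Open (U i)) →
            (∀ x → ∃ λ i → U i x) →
            Σ (List I) λ is → ∀ x → Any (λ i → U i x) is

  Hausdorff : Set₁
  Hausdorff = ∀ x y → ¬ x ≡ y →
    Σ (Subset X) λ U → Σ (Subset X) λ V →
      Open U × Open V × U x × V y × (∀ z → U z → V z → ⊥)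

  ZeroDimensional : Set₁
  ZeroDimensional = ∀ U → Open U → ∀ x → U x →
    Σ (Subset X) λ C → Clopen C × C x × C ⊆ U

  IsStone : Set₁
  IsStone = Compact × Hausdorff × ZeroDimensional

record MKFrame : Set₁ where
  field
    X       : Set
    R       : X → X → Set
    E       : X → X → Set
    inhabited : X
    E-equiv : IsEquivalence E
    E-R-commute : ∀ x y z → E x y → R y z → ∃ λ u → R x u × E u z

  Q : X → X → Set
  Q x y = ∃ λ z → R x z × E z y

  EQ : X → X → Set
  EQ x y = Q x y × Q y x

  R[_] : X → Subset X
  R[ x ] y = R x y

  E[_] : X → Subset X
  E[ x ] y = E x y

  R⁻¹ : Subset X → Subset X
  R⁻¹ U x = ∃ λ y → R x y × U y

  E⁻¹ : Subset X → Subset X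
  E⁻¹ U x = ∃ λ y → E x y × U y

  max : Subset X → Subset X
  max V x = V x × (∀ y → V y → R x y → y ≡ x)

  smax : Subset X → Subset X
  smax V x = max V x × (∀ y → V y → Q x y → E x y)

infixr 5 _⇒_

data Form : Set where
  var  : ℕ → Form
  ⊥'   : Form
  _⇒_  : Form → Form → Form
  ◇    : Form → Form
  ∃'   : Form → Form

¬' : Form → Form
¬' φ = φ ⇒ ⊥'

□ : Form → Form
□ φ = ¬' (◇ (¬' φ))

∀' : Form → Form
∀' φ = ¬' (∃' (¬' φ))

-- MGrz: classical propositional logic (Hilbert style), S4 + Grz for □,
-- S5 for ∀/∃, the left commutativity axiom ∃◇p → ◇∃p,
-- modus ponens and necessitation for □ and ∀ (axioms as schemes,
-- which gives closure under uniform substitution).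
data MGrz⊢ : Form → Set where
  ax-K  : ∀ φ ψ → MGrz⊢ (φ ⇒ ψ ⇒ φ)
  ax-S  : ∀ φ ψ χ → MGrz⊢ ((φ ⇒ ψ ⇒ χ) ⇒ (φ ⇒ ψ) ⇒ φ ⇒ χ)
  ax-DN : ∀ φ → MGrz⊢ (¬' (¬' φ) ⇒ φ)
  □-K   : ∀ φ ψ → MGrz⊢ (□ (φ ⇒ ψ) ⇒ □ φ ⇒ □ ψ)
  □-T   : ∀ φ → MGrz⊢ (□ φ ⇒ φ)
  □-4   : ∀ φ → MGrz⊢ (□ φ ⇒ □ (□ φ))
  □-Grz : ∀ φ → MGrz⊢ (□ (□ (φ ⇒ □ φ) ⇒ φ) ⇒ φ)
  ∀-K   : ∀ φ ψ → MGrz⊢ (∀' (φ ⇒ ψ) ⇒ ∀' φ ⇒ ∀' ψ)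
  ∀-T   : ∀ φ → MGrz⊢ (∀' φ ⇒ φ)
  ∀-4   : ∀ φ → MGrz⊢ (∀' φ ⇒ ∀' (∀' φ))
  ∃-5   : ∀ φ → MGrz⊢ (∃' φ ⇒ ∀' (∃' φ))
  ∃◇    : ∀ φ → MGrz⊢ (∃' (◇ φ) ⇒ ◇ (∃' φ))
  mp    : ∀ {φ ψ} → MGrz⊢ (φ ⇒ ψ) → MGrz⊢ φ → MGrz⊢ ψ
  nec□  : ∀ {φ} → MGrz⊢ φ → MGrz⊢ (□ φ)
  nec∀  : ∀ {φ} → MGrz⊢ φ → MGrz⊢ (∀' φ)

module _ (F : MKFrame) where
  open MKFrame F

  ⟦_⟧ : Form → (ℕ → Subset X) → Subset X
  ⟦ var n ⟧ v = v n
  ⟦ ⊥' ⟧ v x = ⊥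
  ⟦ φ ⇒ ψ ⟧ v x = ⟦ φ ⟧ v x → ⟦ ψ ⟧ v x
  ⟦ ◇ φ ⟧ v = R⁻¹ (⟦ φ ⟧ v)
  ⟦ ∃' φ ⟧ v = E⁻¹ (⟦ φ ⟧ v)

  ValidIn : (Subset X → Set) → Form → Set₁
  ValidIn Adm φ = (v : ℕ → Subset X) → (∀ n → Adm (v n)) → ∀ x → ⟦ φ ⟧ v x

record DescriptiveMGrzFrame : Set₂ where
  field
    frame : MKFrame
  open MKFrame frame public
  field
    topology : Topology X
  open Topology topology public
  field
    stone         : IsStone
    R-point-closed : ∀ x → Closed R[ x ]
    R-clopen       : ∀ U → Clopen U → Clopen (R⁻¹ U)
    E-point-closed : ∀ x → Closed E[ x ]
    E-clopen       : ∀ U → Clopen U → Clopen (E⁻¹ U)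
    validates-MGrz : ∀ φ → MGrz⊢ φ → ValidIn frame Clopen φ

record FiniteMGrzFrame : Set₂ where
  field
    frame : MKFrame
  open MKFrame frame public
  field
    size   : ℕ
    finite : X ↔ Fin size
    -- discrete topology: every subset is clopen
    validates-MGrz : ∀ φ → MGrz⊢ φ → ValidIn frame (λ _ → ⊤) φ

{-# OPTIONS --safe #-}
-- Part (1) needs only that R is a preorder and E ∘ R ⊆ R ∘ E: if z is R-maximal in the
-- Q-cluster of x and y is in that cluster, then z R w E y for some w, and w lies in the
-- cluster again, so w = z and z E y.
--
-- Parts (2) and (3) use the Grz axiom with φ = ¬∃p, where p is a set U containing x all
-- of whose points Q-reachable from x are E-related to x (U = E[x] in the finite case).
-- If y is in the Q-cluster of x but not in E[x], pick x R w E y. Every point of E[w]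
-- satisfies φ ∧ ◇¬φ, and every R-successor of x satisfying ∃p is E-related to x, hence
-- sees E[w]. So x ⊨ □(□(φ → □φ) → φ), and Grz forces x ⊨ ¬∃p, contradicting x ∈ U.
module Submission where

open import Defs
open import Level using (0ℓ)
open import Axiom.ExcludedMiddle using (ExcludedMiddle)
open import Axiom.DoubleNegationElimination using (em⇒dne)
open import Data.Product using (∃; Σ; _×_; _,_; proj₂)
open import Data.Nat using (ℕ)
open import Data.Unit using (⊤; tt)
open import Function.Bundles using (_⇔_; mk⇔)
open import Relation.Nullary using (¬_)
open import Relation.Binary using (IsEquivalence; Reflexive; Transitive)
open import Relation.Binary.PropositionalEquality using (subst)

module MKFrameProperties (F : MKFrame) where
  open MKFrame F
  open IsEquivalence E-equiv
    using () renaming (refl to E-refl; sym to E-sym; trans to E-trans)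

  private
    variable
      x y z : X
      φ : Form
      v : ℕ → Subset X

  ⟦□⟧-intro : (∀ t → R x t → ⟦ F ⟧ φ v t) → ⟦ F ⟧ (□ φ) v x
  ⟦□⟧-intro □φ (t , Rxt , ¬φt) = ¬φt (□φ t Rxt)

  ¬⟦□⟧-intro : ∀ {t} → R x t → ¬ ⟦ F ⟧ φ v t → ¬ ⟦ F ⟧ (□ φ) v x
  ¬⟦□⟧-intro Rxt ¬φt □φ = □φ (_ , Rxt , ¬φt)

  R⇒Q : R x y → Q x y
  R⇒Q Rxy = _ , Rxy , E-refl

  E⇒Q : Reflexive R → E x y → Q x y
  E⇒Q R-refl Exy = _ , R-refl , Exy

  E-Q⇒Q : E x y → Q y z → Q x z
  E-Q⇒Q Exy (a , Rya , Eaz) with E-R-commute _ _ _ Exy Rya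
  ... | u , Rxu , Eua = u , Rxu , E-trans Eua Eaz

  R-Q⇒Q : Transitive R → R x y → Q y z → Q x z
  R-Q⇒Q R-trans Rxy (a , Rya , Eaz) = a , R-trans Rxy Rya , Eaz

  Q-refl : Reflexive R → Reflexive Q
  Q-refl R-refl = E⇒Q R-refl E-refl

  Q-trans : Transitive R → Transitive Q
  Q-trans R-trans (a , Rxa , Eay) yQz = R-Q⇒Q R-trans Rxa (E-Q⇒Q Eay yQz)

  E⇒EQ : Reflexive R → E x y → EQ x y
  E⇒EQ R-refl Exy = E⇒Q R-refl Exy , E⇒Q R-refl (E-sym Exy)

  module _ (R-refl : Reflexive R) (R-trans : Transitive R) where

    max-EQ⇒E : max (EQ x) z → EQ x y → E z y
    max-EQ⇒E {x = x} {y = y} ((xQz , zQx) , z-max) (xQy , yQx) with Q-trans R-trans zQx xQy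
    ... | w , Rzw , Ewy = subst (λ t → E t y) (z-max w wEQx Rzw) Ewy
      where
      wEQx : EQ x w
      wEQx = Q-trans R-trans xQz (R⇒Q Rzw) , E-Q⇒Q Ewy yQx

    EQ⇒E-of-max-EQ : max (EQ x) z → EQ x y → E x y
    EQ⇒E-of-max-EQ {x} z-max xEQy =
      E-trans (E-sym (max-EQ⇒E z-max xEQx)) (max-EQ⇒E z-max xEQy)
      where
      xEQx : EQ x x
      xEQx = Q-refl R-refl , Q-refl R-refl

  module _ {Adm : Subset X → Set}
           (grz : ∀ φ → ValidIn F Adm (□ (□ (φ ⇒ □ φ) ⇒ φ) ⇒ φ))
           {U : Subset X} (Adm-U : Adm U) (Ux : U x)
           (U-Q⇒E : ∀ z → U z → Q x z → E x z) where

    private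
      p : ℕ → Subset X
      p _ = U

      ¬∃p : Form
      ¬∃p = ¬' (∃' (var 0))

    R-∃U⇒E : ∀ {s} → R x s → E⁻¹ U s → E x s
    R-∃U⇒E Rxs (z , Esz , Uz) = E-trans (U-Q⇒E z Uz (_ , Rxs , Esz)) (E-sym Esz)

    EQ⇒¬¬E : EQ x y → ¬ ¬ E x y
    EQ⇒¬¬E {y} ((w , Rxw , Ewy) , (a , Rya , Eax)) ¬Exy =
      grz ¬∃p p (λ _ → Adm-U) x
        (⟦□⟧-intro {φ = □ (¬∃p ⇒ □ ¬∃p) ⇒ ¬∃p} {v = p} premise) (x , E-refl , Ux)
      where
      refutes : ∀ {w′} → E w′ w → ¬ ⟦ F ⟧ (¬∃p ⇒ □ ¬∃p) p w′
      refutes {w′} Ew′w ¬∃p⇒□¬∃p with E-Q⇒Q (E-trans Ew′w Ewy) (R⇒Q Rya)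
      ... | r , Rw′r , Era =
        ¬⟦□⟧-intro {φ = ¬∃p} {v = p} Rw′r (λ ¬∃Ur → ¬∃Ur (x , E-trans Era Eax , Ux))
          (¬∃p⇒□¬∃p ¬∃Uw′)
        where
        ¬∃Uw′ : ⟦ F ⟧ ¬∃p p w′
        ¬∃Uw′ (z , Ew′z , Uz) =
          ¬Exy (E-trans (R-∃U⇒E Rxw (z , E-trans (E-sym Ew′w) Ew′z , Uz)) Ewy)

      premise : ∀ s → R x s → ⟦ F ⟧ (□ (¬∃p ⇒ □ ¬∃p) ⇒ ¬∃p) p s
      premise s Rxs □[¬∃p⇒□¬∃p] ∃Us with E-R-commute s x w (E-sym (R-∃U⇒E Rxs ∃Us)) Rxw
      ... | w′ , Rsw′ , Ew′w =
        ¬⟦□⟧-intro {φ = ¬∃p ⇒ □ ¬∃p} {v = p} Rsw′ (refutes Ew′w) □[¬∃p⇒□¬∃p]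

module DescriptiveMGrzFrameProperties (em : ExcludedMiddle 0ℓ) (F : DescriptiveMGrzFrame) where
  open DescriptiveMGrzFrame F
  open MKFrameProperties frame

  private
    variable
      x y : X

    zero-dimensional : ZeroDimensional
    zero-dimensional = proj₂ (proj₂ stone)

    grz-valid : ∀ φ → ValidIn frame Clopen (□ (□ (φ ⇒ □ φ) ⇒ φ) ⇒ φ)
    grz-valid φ = validates-MGrz _ (□-Grz φ)

  clopen-avoiding-R[_] : ∀ x {z} → ¬ R x z →
    Σ (Subset X) λ C → Clopen C × C z × (∀ t → R x t → ¬ C t)
  clopen-avoiding-R[ x ] {z} ¬Rxz
    with zero-dimensional (∁ R[ x ]) (R-point-closed x) z ¬Rxz
  ... | C , clopen-C , Cz , C⊆∁R[x] = C , clopen-C , Cz , λ t Rxt Ct → C⊆∁R[x] t Ct Rxt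

  R-refl : Reflexive R
  R-refl {x} = em⇒dne em λ ¬Rxx →
    let C , clopen-C , Cx , avoids-C = clopen-avoiding-R[ x ] ¬Rxx
        v = λ _ → C
    in validates-MGrz _ (□-T (¬' (var 0))) v (λ _ → clopen-C) x
         (⟦□⟧-intro {φ = ¬' (var 0)} {v = v} avoids-C) Cx

  R-trans : Transitive R
  R-trans {x} {y} {z} Rxy Ryz = em⇒dne em λ ¬Rxz →
    let C , clopen-C , Cz , avoids-C = clopen-avoiding-R[ x ] ¬Rxz
        v = λ _ → C
    in ¬⟦□⟧-intro {φ = □ (¬' (var 0))} {v = v} Rxy
         (¬⟦□⟧-intro {φ = ¬' (var 0)} {v = v} Ryz λ ¬Cz → ¬Cz Cz)
         (validates-MGrz _ (□-4 (¬' (var 0))) v (λ _ → clopen-C) x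
           (⟦□⟧-intro {φ = ¬' (var 0)} {v = v} avoids-C))

  EQ⇔E-of-max-EQ : (∃ λ z → max (EQ x) z) → EQ x y ⇔ E x y
  EQ⇔E-of-max-EQ (_ , z-max) = mk⇔ (EQ⇒E-of-max-EQ R-refl R-trans z-max) (E⇒EQ R-refl)

  EQ⇔E-of-smax : ∀ {U} → Clopen U → smax U x → EQ x y ⇔ E x y
  EQ⇔E-of-smax clopen-U ((Ux , _) , U-Q⇒E) = mk⇔
    (λ xEQy → em⇒dne em (EQ⇒¬¬E grz-valid clopen-U Ux U-Q⇒E xEQy))
    (E⇒EQ R-refl)

module FiniteMGrzFrameProperties (em : ExcludedMiddle 0ℓ) (F : FiniteMGrzFrame) where
  open FiniteMGrzFrame F
  open MKFrameProperties frame
  open IsEquivalence E-equiv using () renaming (refl to E-refl)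

  private
    grz-valid : ∀ φ → ValidIn frame (λ _ → ⊤) (□ (□ (φ ⇒ □ φ) ⇒ φ) ⇒ φ)
    grz-valid φ = validates-MGrz _ (□-Grz φ)

  R-refl : Reflexive R
  R-refl {x} = validates-MGrz _ (□-T (var 0)) v (λ _ → tt) x
    (⟦□⟧-intro {φ = var 0} {v = v} λ _ Rxt → Rxt)
    where
    v : ℕ → Subset X
    v _ = R[ x ]

  EQ⇔E : ∀ x y → EQ x y ⇔ E x y
  EQ⇔E x y = mk⇔
    (λ xEQy → em⇒dne em (EQ⇒¬¬E grz-valid {U = E[ x ]} tt E-refl (λ _ Exz _ → Exz) xEQy))
    (E⇒EQ R-refl)

lemma6p18 : ExcludedMiddle 0ℓ →
    ((F : DescriptiveMGrzFrame) (x : DescriptiveMGrzFrame.X F) →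
      let open DescriptiveMGrzFrame F in
      ((∃ λ y → max (EQ x) y) → ∀ y → EQ x y ⇔ E x y)
      × (∀ U → Clopen U → smax U x → ∀ y → EQ x y ⇔ E x y))
    × ((F : FiniteMGrzFrame) →
      let open FiniteMGrzFrame F in
      ∀ x y → EQ x y ⇔ E x y)
lemma6p18 em =
  (λ F x → let open DescriptiveMGrzFrameProperties em F in
      (λ max-nonempty _ → EQ⇔E-of-max-EQ max-nonempty)
    , (λ _ clopen-U x-smax _ → EQ⇔E-of-smax clopen-U x-smax))
  , λ F → FiniteMGrzFrameProperties.EQ⇔E em F
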